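{- Let $G$ be a multigraph of order $n$. (a) If $G$ has no edges, then $P(\mathcal{H}_G,\lambda)=\lambda^n$. (b) If $e$ is a loop of $G$, then $P(\mathcal{H}_G,\lambda)=(\lambda-1)P(\mathcal{H}_{G-e},\lambda)$. (c) If $e$ is a bridge of $G$, then $P(\mathcal{H}_G,\lambda)=(\lambda^2-1)P(\mathcal{H}_{G/e},\lambda)$.
   Context: A hypergraph $\mathcal{H}=(\mathcal{V},\mathcal{E})$ has a finite vertex set and a set of edges, each a subset of $\mathcal{V}$ of size at least 1. For positive integer $\lambda$, a weak proper $\lambda$-colouring is a map $\phi:\mathcal{V}\to\{1,\dots,\lambda\}$ with $|\{\phi(v):v\in e\}|>1$ for each edge $e$; $P(\mathcal{H},\lambda)$ is the polynomial counting them. For a multigraph $G=(V,E)$ (loops and parallel edges allowed), $\mathcal{H}_G$ has vertex set $V\cup\{w_f:f\in E\}$ (new distinct vertices) and edge set $\{\{u_f,v_f,w_f\}:f\in E\}$, with $u_f,v_f$ the ends of $f$. $G-e$ denotes deletion of $e$, $G/e$ contraction of $e$ (identify its ends and delete $e$). A bridge of $G$ is an edge whose deletion increases the number of components. -}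

module Defs where

open import Data.Nat using (ℕ; zero; suc; _+_; _<_; _<?_)
open import Data.Fin using (Fin; zero; suc; punchIn; punchOut; _↑ˡ_; _↑ʳ_; _≟_)
open import Data.Fin.Properties using (all?)
open import Data.List using (List; []; _∷_; [_]; map; concatMap; filter; length; deduplicate)
open import Data.List.Relation.Unary.All using (All)
import Data.List.Relation.Unary.All as All
open import Data.List.Relation.Unary.Any using (Any)
open import Data.Product using (_×_; _,_; proj₁; proj₂; ∃; ∃-syntax; Σ-syntax)
open import Data.Sum using (_⊎_)
open import Function using (_∘_; _⇔_)
open import Relation.Binary.PropositionalEquality using (_≡_; _≢_)
open import Relation.Binary.Construct.Closure.ReflexiveTransitive using (Star)
open import Relation.Nullary using (yes; no; ¬_)
open import Function.Definitions using (Surjective)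

record Hypergraph : Set where
  constructor mkHG
  field
    order  : ℕ
    nEdges : ℕ
    edge   : Fin nEdges → List (Fin order)
    edge-nonempty : (i : Fin nEdges) → ¬ (edge i ≡ [])
open Hypergraph public

Colouring : ℕ → ℕ → Set
Colouring N q = Fin N → Fin q

numColours : ∀ {N q} → Colouring N q → List (Fin N) → ℕ
numColours φ e = length (deduplicate _≟_ (map φ e))

WeakProper : (H : Hypergraph) → ∀ {q} → Colouring (order H) q → Set
WeakProper H φ = (i : Fin (nEdges H)) → 1 < numColours φ (edge H i)

weakProper? : (H : Hypergraph) → ∀ {q} → (φ : Colouring (order H) q) →
              Relation.Nullary.Dec (WeakProper H φ)
weakProper? H φ = all? (λ i → 1 <? numColours φ (edge H i))

consC : ∀ {N q} → Fin q → Colouring N q → Colouring (suc N) q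
consC c φ zero    = c
consC c φ (suc i) = φ i

allFin' : (q : ℕ) → List (Fin q)
allFin' zero    = []
allFin' (suc q) = zero ∷ map suc (allFin' q)

allColourings : (N q : ℕ) → List (Colouring N q)
allColourings zero    q = [ (λ ()) ]
allColourings (suc N) q =
  concatMap (λ c → map (consC c) (allColourings N q)) (allFin' q)

-- chromatic polynomial P(H, q) evaluated at q: number of weak proper q-colourings
P : Hypergraph → ℕ → ℕ
P H q = length (filter (weakProper? H) (allColourings (order H) q))

-- Multigraphs: vertices Fin order, edges indexed by Fin size,
-- edge f has ends (ends f); loops and parallel edges allowed.

record Multigraph : Set where
  constructor mkMG
  field
    order : ℕ
    size  : ℕ
    ends  : Fin size → Fin order × Fin order
open Multigraph public

-- the hypergraph H_G: vertices Fin (n + m), v ↦ inject+ m v, w_f = n ↑ʳ f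
H : Multigraph → Hypergraph
H (mkMG n m ends) = mkHG (n + m) m
  (λ f → (proj₁ (ends f) ↑ˡ m) ∷ (proj₂ (ends f) ↑ˡ m) ∷ (n ↑ʳ f) ∷ [])
  (λ f ())

delete : (G : Multigraph) → Fin (size G) → Multigraph
delete (mkMG n (suc m) ends) e = mkMG n m (ends ∘ punchIn e)

merge : ∀ {k} (u v : Fin (suc k)) → v ≢ u → Fin (suc k) → Fin k
merge u v v≢u x with v ≟ x
... | yes _  = punchOut v≢u
... | no v≢x = punchOut v≢x

-- contraction G / e: identify the ends of e and delete e
-- (for a loop this is just deletion)
contract : (G : Multigraph) → Fin (size G) → Multigraph
contract G@(mkMG n (suc m) ends) e with ends e
... | u , v with v ≟ u
...   | yes _ = delete G e
contract (mkMG (suc k) (suc m) ends) e | u , v | no v≢u =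
  mkMG k m (λ f → let (a , b) = ends (punchIn e f) in
                  merge u v v≢u a , merge u v v≢u b)

Adj : (G : Multigraph) → Fin (order G) → Fin (order G) → Set
Adj G x y = ∃[ f ] (ends G f ≡ (x , y) ⊎ ends G f ≡ (y , x))

Connected : (G : Multigraph) → Fin (order G) → Fin (order G) → Set
Connected G = Star (Adj G)

HasComponents : Multigraph → ℕ → Set
HasComponents G c =
  Σ[ label ∈ (Fin (order G) → Fin c) ]
    (Surjective _≡_ _≡_ label ×
     (∀ x y → (label x ≡ label y) ⇔ Connected G x y))

IsBridge : (G : Multigraph) → Fin (size G) → Set
IsBridge G e = ∃[ c ] ∃[ c' ] (HasComponents G c × HasComponents (delete G e) c' × c < c')

module Submission where

-- P(H_G, q) is the sum, over all q-colourings of the n + m vertices of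
-- H_G, of the indicator that no hyperedge {u_f, v_f, w_f} is monochromatic.
-- Fix an edge e = uv and sum first over the colour of w_e: for a colouring ψ of
-- the remaining vertices, i.e. of H_{G-e}, exactly q - [ψ u = ψ v] colours are
-- admissible.  This gives the deletion identity
--     P(H_G) + Agree_{G-e}(u, v) = q · P(H_{G-e}),
-- where Agree counts weak proper colourings of H_{G-e} with ψ u = ψ v.
--  (a) With no edges every colouring counts: q ^ n.
--  (b) For a loop u = v, so Agree = P(H_{G-e}), whence P(H_G) = (q - 1) P(H_{G-e}).
--  (c) For a bridge, u and v lie in different components of G - e; permuting the
--      colours on v's component shows P(H_{G-e}) = q · Agree, and colourings with
--      ψ u = ψ v are exactly colourings of H_{G/e}, so P(H_G) = (q² - 1) P(H_{G/e}).

open import Defs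
open import Algebra.Properties.CommutativeSemigroup using (interchange)
open import Data.Bool using (Bool; true; false; if_then_else_)
open import Data.Empty using (⊥-elim)
open import Data.Fin using (Fin; zero; suc; _↑ˡ_; _↑ʳ_; splitAt; punchIn; punchOut)
open import Data.Fin.Permutation using (Permutation; _⟨$⟩ʳ_; _⟨$⟩ˡ_; inverseˡ; inverseʳ; flip; transpose)
open import Data.Fin.Properties using (all?; _≟_; splitAt-↑ˡ; splitAt-↑ʳ; splitAt⁻¹-↑ˡ; splitAt⁻¹-↑ʳ; punchInᵢ≢i; punchOut-cong; punchIn-punchOut; punchOut-punchIn; injective⇒≤)
open import Data.List using (List; []; _∷_; map; concatMap; filter; length; deduplicate; _++_)
open import Data.List.Properties using (length-map)
open import Data.Nat using (ℕ; zero; suc; _+_; _*_; _∸_; _^_; _≤_; _<_; s≤s; z≤n)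
open import Data.Nat.Properties using (+-assoc; +-identityʳ; *-zeroʳ; *-identityˡ; *-identityʳ; *-comm; *-assoc; *-distribˡ-+; *-distribʳ-+; *-distribʳ-∸; m+n∸n≡m; <⇒≱; +-commutativeSemigroup)
open import Data.Product using (_×_; _,_; proj₁; proj₂)
open import Data.Sum using (_⊎_; inj₁; inj₂)
open import Function using (_∘_; id; Equivalence)
open import Relation.Binary.PropositionalEquality
open import Relation.Binary.Construct.Closure.ReflexiveTransitive as Star using (ε; _◅_; reverse)
open import Relation.Nullary using (Dec; yes; no; ¬_; ¬?; does; _×-dec_)
open import Relation.Nullary.Decidable using (dec-true; dec-false)
open import Relation.Nullary.Negation using (contradiction)

∑ : {A : Set} → List A → (A → ℕ) → ℕ
∑ []       f = 0
∑ (x ∷ xs) f = f x + ∑ xs f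

∑-cong : {A : Set} (xs : List A) {f g : A → ℕ} → (∀ x → f x ≡ g x) → ∑ xs f ≡ ∑ xs g
∑-cong []       f≗g = refl
∑-cong (x ∷ xs) f≗g = cong₂ _+_ (f≗g x) (∑-cong xs f≗g)

∑-map : {A B : Set} (g : A → B) (xs : List A) (f : B → ℕ) → ∑ (map g xs) f ≡ ∑ xs (f ∘ g)
∑-map g []       f = refl
∑-map g (x ∷ xs) f = cong (f (g x) +_) (∑-map g xs f)

∑-++ : {A : Set} (xs ys : List A) (f : A → ℕ) → ∑ (xs ++ ys) f ≡ ∑ xs f + ∑ ys f
∑-++ []       ys f = refl
∑-++ (x ∷ xs) ys f = trans (cong (f x +_) (∑-++ xs ys f)) (sym (+-assoc (f x) _ _))

∑-concatMap : {A B : Set} (g : A → List B) (xs : List A) (f : B → ℕ) →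
              ∑ (concatMap g xs) f ≡ ∑ xs (λ x → ∑ (g x) f)
∑-concatMap g []       f = refl
∑-concatMap g (x ∷ xs) f =
  trans (∑-++ (g x) (concatMap g xs) f) (cong (∑ (g x) f +_) (∑-concatMap g xs f))

∑-const : {A : Set} (xs : List A) (k : ℕ) → ∑ xs (λ _ → k) ≡ length xs * k
∑-const []       k = refl
∑-const (x ∷ xs) k = cong (k +_) (∑-const xs k)

∑-+ : {A : Set} (xs : List A) (f g : A → ℕ) → ∑ xs (λ x → f x + g x) ≡ ∑ xs f + ∑ xs g
∑-+ []       f g = refl
∑-+ (x ∷ xs) f g = trans (cong (f x + g x +_) (∑-+ xs f g))
                         (interchange +-commutativeSemigroup (f x) (g x) (∑ xs f) (∑ xs g))

∑-*ˡ : {A : Set} (k : ℕ) (xs : List A) (f : A → ℕ) → ∑ xs (λ x → k * f x) ≡ k * ∑ xs f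
∑-*ˡ k []       f = sym (*-zeroʳ k)
∑-*ˡ k (x ∷ xs) f = trans (cong (k * f x +_) (∑-*ˡ k xs f)) (sym (*-distribˡ-+ k (f x) _))

∑-*ʳ : {A : Set} (k : ℕ) (xs : List A) (f : A → ℕ) → ∑ xs (λ x → f x * k) ≡ ∑ xs f * k
∑-*ʳ k xs f = trans (∑-cong xs (λ x → *-comm (f x) k)) (trans (∑-*ˡ k xs f) (*-comm k _))

∑-swap : {A B : Set} (xs : List A) (ys : List B) (f : A → B → ℕ) →
         ∑ xs (λ x → ∑ ys (f x)) ≡ ∑ ys (λ y → ∑ xs (λ x → f x y))
∑-swap []       ys f = sym (trans (∑-const ys 0) (*-zeroʳ (length ys)))
∑-swap (x ∷ xs) ys f = trans (cong (∑ ys (f x) +_) (∑-swap xs ys f))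
                             (sym (∑-+ ys (f x) (λ y → ∑ xs (λ x' → f x' y))))

-- The indicator (0 or 1) of a decided proposition; it only inspects the
-- decision bit, so it is unchanged by 'Dec.map′'.
ind : {A : Set} → Dec A → ℕ
ind d = if does d then 1 else 0

ind-yes : {A : Set} (d : Dec A) → A → ind d ≡ 1
ind-yes (yes _) a = refl
ind-yes (no ¬a) a = contradiction a ¬a

ind-no : {A : Set} (d : Dec A) → ¬ A → ind d ≡ 0
ind-no (yes a) ¬a = contradiction a ¬a
ind-no (no _)  ¬a = refl

ind-⇔ : {A B : Set} (d : Dec A) (d' : Dec B) → (A → B) → (B → A) → ind d ≡ ind d'
ind-⇔ (yes a) d' to from = sym (ind-yes d' (to a))
ind-⇔ (no ¬a) d' to from = sym (ind-no d' (¬a ∘ from))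

ind-× : {A B : Set} (d : Dec A) (d' : Dec B) → ind (d ×-dec d') ≡ ind d * ind d'
ind-× (yes _) (yes _) = refl
ind-× (yes _) (no _)  = refl
ind-× (no _)  d'      = refl

ind-¬ : {A : Set} (d : Dec A) (d' : Dec (¬ A)) → ind d' + ind d ≡ 1
ind-¬ (yes a) d' rewrite ind-no d' (λ ¬a → ¬a a) = refl
ind-¬ (no ¬a) d' rewrite ind-yes d' ¬a = refl

length-allFin' : (q : ℕ) → length (allFin' q) ≡ q
length-allFin' zero    = refl
length-allFin' (suc q) = cong suc (trans (length-map suc (allFin' q)) (length-allFin' q))

∑-colours-const : (q k : ℕ) → ∑ (allFin' q) (λ _ → k) ≡ q * k
∑-colours-const q k = trans (∑-const (allFin' q) k) (cong (_* k) (length-allFin' q))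

∑-colours-δ : (q : ℕ) (g : Fin q → ℕ) (d : Fin q) → ∑ (allFin' q) (λ c → g c * ind (d ≟ c)) ≡ g d
∑-colours-δ (suc q) g zero = begin
    g zero * 1 + ∑ (map suc (allFin' q)) (λ c → g c * ind (zero ≟ c))
  ≡⟨ cong (g zero * 1 +_) (∑-map suc (allFin' q) _) ⟩
    g zero * 1 + ∑ (allFin' q) (λ c → g (suc c) * 0)
  ≡⟨ cong (g zero * 1 +_) (trans (∑-cong (allFin' q) (λ c → *-zeroʳ (g (suc c))))
                                 (trans (∑-const (allFin' q) 0) (*-zeroʳ (length (allFin' q))))) ⟩
    g zero * 1 + 0
  ≡⟨ trans (+-identityʳ _) (*-identityʳ _) ⟩
    g zero ∎
  where open ≡-Reasoning
∑-colours-δ (suc q) g (suc d) =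
  trans (cong₂ _+_ (*-zeroʳ (g zero)) (∑-map suc (allFin' q) _)) (∑-colours-δ q (g ∘ suc) d)

≗? : {N q : ℕ} (φ ψ : Colouring N q) → Dec (φ ≗ ψ)
≗? φ ψ = all? (λ i → φ i ≟ ψ i)

Extensional : {N q : ℕ} → (Colouring N q → ℕ) → Set
Extensional f = ∀ {φ ψ} → φ ≗ ψ → f φ ≡ f ψ

∑C : (N q : ℕ) → (Colouring N q → ℕ) → ℕ
∑C N q f = ∑ (allColourings N q) f

∑C-cong : (N q : ℕ) {f g : Colouring N q → ℕ} → (∀ φ → f φ ≡ g φ) → ∑C N q f ≡ ∑C N q g
∑C-cong N q = ∑-cong (allColourings N q)

∑C-suc : (N q : ℕ) (f : Colouring (suc N) q → ℕ) →
         ∑C (suc N) q f ≡ ∑ (allFin' q) (λ c → ∑C N q (f ∘ consC c))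
∑C-suc N q f = trans (∑-concatMap _ (allFin' q) f)
                     (∑-cong (allFin' q) (λ c → ∑-map (consC c) (allColourings N q) f))

∑C-one : (N q : ℕ) → ∑C N q (λ _ → 1) ≡ q ^ N
∑C-one zero    q = refl
∑C-one (suc N) q = trans (∑C-suc N q _)
                         (trans (∑-cong (allFin' q) (λ c → ∑C-one N q)) (∑-colours-const q (q ^ N)))

ind-≗-consC : {N q : ℕ} (χ : Colouring (suc N) q) (c : Fin q) (ψ : Colouring N q) →
              ind (≗? χ (consC c ψ)) ≡ ind (χ zero ≟ c) * ind (≗? (χ ∘ suc) ψ)
ind-≗-consC χ c ψ =
  trans (ind-⇔ (≗? χ (consC c ψ)) ((χ zero ≟ c) ×-dec ≗? (χ ∘ suc) ψ)
               (λ χ≗ → χ≗ zero , χ≗ ∘ suc)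
               (λ { (p , _) zero → p ; (_ , ps) (suc i) → ps i }))
        (ind-× (χ zero ≟ c) (≗? (χ ∘ suc) ψ))

∑C-δ : (N q : ℕ) (g : Colouring N q → ℕ) → Extensional g → (χ : Colouring N q) →
       ∑C N q (λ ψ → g ψ * ind (≗? χ ψ)) ≡ g χ
∑C-δ zero q g ext χ = begin
    g (λ ()) * ind (≗? χ (λ ())) + 0
  ≡⟨ cong (λ z → g (λ ()) * z + 0) (ind-yes (≗? χ (λ ())) (λ ())) ⟩
    g (λ ()) * 1 + 0
  ≡⟨ trans (+-identityʳ _) (*-identityʳ _) ⟩
    g (λ ())
  ≡⟨ ext (λ ()) ⟩
    g χ ∎
  where open ≡-Reasoning
∑C-δ (suc N) q g ext χ = begin
    ∑C (suc N) q (λ ψ → g ψ * ind (≗? χ ψ))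
  ≡⟨ ∑C-suc N q _ ⟩
    ∑ (allFin' q) (λ c → ∑C N q (λ ψ → g (consC c ψ) * ind (≗? χ (consC c ψ))))
  ≡⟨ ∑-cong (allFin' q) (λ c → ∑C-cong N q (λ ψ → cong (g (consC c ψ) *_) (ind-≗-consC χ c ψ))) ⟩
    ∑ (allFin' q) (λ c → ∑C N q (λ ψ → g (consC c ψ) * (ind (χ zero ≟ c) * ind (≗? (χ ∘ suc) ψ))))
  ≡⟨ ∑-cong (allFin' q) (λ c → trans (∑C-cong N q (λ ψ → rearrange (g (consC c ψ)) _ _))
                                     (∑-*ʳ (ind (χ zero ≟ c)) (allColourings N q) _)) ⟩
    ∑ (allFin' q) (λ c → ∑C N q (λ ψ → g (consC c ψ) * ind (≗? (χ ∘ suc) ψ)) * ind (χ zero ≟ c))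
  ≡⟨ ∑-cong (allFin' q) (λ c → cong (_* ind (χ zero ≟ c))
                                     (∑C-δ N q (g ∘ consC c) (ext ∘ consC-cong c) (χ ∘ suc))) ⟩
    ∑ (allFin' q) (λ c → g (consC c (χ ∘ suc)) * ind (χ zero ≟ c))
  ≡⟨ ∑-colours-δ q (λ c → g (consC c (χ ∘ suc))) (χ zero) ⟩
    g (consC (χ zero) (χ ∘ suc))
  ≡⟨ ext (λ { zero → refl ; (suc i) → refl }) ⟩
    g χ ∎
  where
  open ≡-Reasoning
  rearrange : ∀ a b c → a * (b * c) ≡ a * c * b
  rearrange a b c = trans (cong (a *_) (*-comm b c)) (sym (*-assoc a c b))
  consC-cong : ∀ c {φ ψ : Colouring N q} → φ ≗ ψ → consC c φ ≗ consC c ψ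
  consC-cong c φ≗ψ zero    = refl
  consC-cong c φ≗ψ (suc i) = φ≗ψ i

-- Sums of extensional weights are invariant under a bijection F of colourings
-- (with inverse G, both respecting ≗): write f (F φ) as a δ-sum and swap.
∑C-reindex : (N M q : ℕ) (F : Colouring N q → Colouring M q) (G : Colouring M q → Colouring N q) →
             (∀ {φ φ'} → φ ≗ φ' → F φ ≗ F φ') → (∀ {ψ ψ'} → ψ ≗ ψ' → G ψ ≗ G ψ') →
             (∀ φ → G (F φ) ≗ φ) → (∀ ψ → F (G ψ) ≗ ψ) →
             (f : Colouring M q → ℕ) → Extensional f → ∑C M q f ≡ ∑C N q (f ∘ F)
∑C-reindex N M q F G F-cong G-cong GF FG f ext = sym (begin
    ∑C N q (f ∘ F)
  ≡⟨ ∑C-cong N q (λ φ → sym (∑C-δ M q f ext (F φ))) ⟩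
    ∑C N q (λ φ → ∑C M q (λ ψ → f ψ * ind (≗? (F φ) ψ)))
  ≡⟨ ∑-swap (allColourings N q) (allColourings M q) _ ⟩
    ∑C M q (λ ψ → ∑C N q (λ φ → f ψ * ind (≗? (F φ) ψ)))
  ≡⟨ ∑C-cong M q (λ ψ → ∑C-cong N q (λ φ → cong (f ψ *_) (inverse-δ φ ψ))) ⟩
    ∑C M q (λ ψ → ∑C N q (λ φ → f ψ * ind (≗? (G ψ) φ)))
  ≡⟨ ∑C-cong M q (λ ψ → ∑C-δ N q (λ _ → f ψ) (λ _ → refl) (G ψ)) ⟩
    ∑C M q f ∎)
  where
  open ≡-Reasoning
  inverse-δ : ∀ φ ψ → ind (≗? (F φ) ψ) ≡ ind (≗? (G ψ) φ)
  inverse-δ φ ψ = ind-⇔ (≗? (F φ) ψ) (≗? (G ψ) φ)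
    (λ Fφ≗ψ i → trans (sym (G-cong Fφ≗ψ i)) (GF φ i))
    (λ Gψ≗φ i → trans (sym (F-cong Gψ≗φ i)) (FG ψ i))

∑C-peel : (K N q : ℕ) (σ : Fin K → Fin (suc N)) (τ : Fin (suc N) → Fin K) →
          (∀ j → τ (σ j) ≡ j) → (∀ j → σ (τ j) ≡ j) →
          (f : Colouring K q → ℕ) → Extensional f →
          ∑C K q f ≡ ∑ (allFin' q) (λ c → ∑C N q (λ ψ → f (consC c ψ ∘ σ)))
∑C-peel K N q σ τ τσ στ f ext =
  trans (∑C-reindex (suc N) K q (_∘ σ) (_∘ τ) (λ φ≗ → φ≗ ∘ σ) (λ ψ≗ → ψ≗ ∘ τ)
                    (λ φ i → cong φ (στ i)) (λ ψ i → cong ψ (τσ i)) f ext)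
        (∑C-suc N q (f ∘ (_∘ σ)))

Monochromatic : {q : ℕ} → Fin q × Fin q × Fin q → Set
Monochromatic (a , b , c) = a ≡ b × b ≡ c

monochromatic? : {q : ℕ} (t : Fin q × Fin q × Fin q) → Dec (Monochromatic t)
monochromatic? (a , b , c) = (a ≟ b) ×-dec (b ≟ c)

two-colours⇒non-mono : {q : ℕ} (a b c : Fin q) →
  1 < length (deduplicate _≟_ (a ∷ b ∷ c ∷ [])) → ¬ Monochromatic (a , b , c)
two-colours⇒non-mono a b c two (refl , refl) with a ≟ a
... | yes _   = contradiction two (λ { (s≤s ()) })
... | no a≢a  = a≢a refl

non-mono⇒two-colours : {q : ℕ} (a b c : Fin q) →
  ¬ Monochromatic (a , b , c) → 1 < length (deduplicate _≟_ (a ∷ b ∷ c ∷ []))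
non-mono⇒two-colours a b c non-mono with b ≟ c | a ≟ b
... | yes b≡c | yes a≡b = contradiction (a≡b , b≡c) non-mono
... | yes _   | no _    = s≤s (s≤s z≤n)
... | no _    | no _    = s≤s (s≤s z≤n)
... | no b≢c  | yes a≡b with a ≟ c
...   | yes a≡c = contradiction (trans (sym a≡b) a≡c) b≢c
...   | no _    = s≤s (s≤s z≤n)

non-mono-count : (q : ℕ) (a b : Fin q) →
  ∑ (allFin' q) (λ c → ind (¬? (monochromatic? (a , b , c)))) + ind (a ≟ b) ≡ q
non-mono-count q a b = begin
    ∑ (allFin' q) (λ c → ind (¬? (monochromatic? (a , b , c)))) + ind (a ≟ b)
  ≡⟨ cong (∑ (allFin' q) (λ c → ind (¬? (monochromatic? (a , b , c)))) +_)
          (sym (∑-colours-δ q (λ _ → ind (a ≟ b)) b)) ⟩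
    ∑ (allFin' q) (λ c → ind (¬? (monochromatic? (a , b , c))))
      + ∑ (allFin' q) (λ c → ind (a ≟ b) * ind (b ≟ c))
  ≡⟨ sym (∑-+ (allFin' q) _ _) ⟩
    ∑ (allFin' q) (λ c → ind (¬? (monochromatic? (a , b , c))) + ind (a ≟ b) * ind (b ≟ c))
  ≡⟨ ∑-cong (allFin' q) (λ c →
       trans (cong (ind (¬? (monochromatic? (a , b , c))) +_) (sym (ind-× (a ≟ b) (b ≟ c))))
             (ind-¬ (monochromatic? (a , b , c)) (¬? (monochromatic? (a , b , c))))) ⟩
    ∑ (allFin' q) (λ _ → 1)
  ≡⟨ trans (∑-colours-const q 1) (*-identityʳ q) ⟩
    q ∎
  where open ≡-Reasoning

edgeColours : {n m q : ℕ} (ends : Fin m → Fin n × Fin n) → Colouring (n + m) q →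
              Fin m → Fin q × Fin q × Fin q
edgeColours {n} {m} ends φ f = φ (proj₁ (ends f) ↑ˡ m) , φ (proj₂ (ends f) ↑ˡ m) , φ (n ↑ʳ f)

NoMono : {m q : ℕ} → (Fin m → Fin q × Fin q × Fin q) → Set
NoMono t = ∀ f → ¬ Monochromatic (t f)

noMono? : {m q : ℕ} (t : Fin m → Fin q × Fin q × Fin q) → Dec (NoMono t)
noMono? t = all? (λ f → ¬? (monochromatic? (t f)))

noMono-cong : {m q : ℕ} (t t' : Fin m → Fin q × Fin q × Fin q) → (∀ f → t f ≡ t' f) →
              ind (noMono? t) ≡ ind (noMono? t')
noMono-cong t t' t≗t' = ind-⇔ (noMono? t) (noMono? t')
  (λ nm f → subst (¬_ ∘ Monochromatic) (t≗t' f) (nm f))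
  (λ nm f → subst (¬_ ∘ Monochromatic) (sym (t≗t' f)) (nm f))

noMono-punchIn : {m q : ℕ} (t : Fin (suc m) → Fin q × Fin q × Fin q) (e : Fin (suc m)) →
                 ind (noMono? t) ≡ ind (¬? (monochromatic? (t e))) * ind (noMono? (t ∘ punchIn e))
noMono-punchIn t e = trans
  (ind-⇔ (noMono? t) (¬? (monochromatic? (t e)) ×-dec noMono? (t ∘ punchIn e))
         (λ nm → nm e , nm ∘ punchIn e) join)
  (ind-× (¬? (monochromatic? (t e))) (noMono? (t ∘ punchIn e)))
  where
  join : ¬ Monochromatic (t e) × NoMono (t ∘ punchIn e) → NoMono t
  join (nm-e , nm-rest) f with e ≟ f
  ... | yes refl = nm-e
  ... | no e≢f   = subst (¬_ ∘ Monochromatic ∘ t) (punchIn-punchOut e≢f) (nm-rest (punchOut e≢f))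

proper? : {n m q : ℕ} (ends : Fin m → Fin n × Fin n) (φ : Colouring (n + m) q) →
          Dec (NoMono (edgeColours ends φ))
proper? ends φ = noMono? (edgeColours ends φ)

P-as-sum : (G : Multigraph) (q : ℕ) →
           P (H G) q ≡ ∑C (order G + size G) q (λ φ → ind (proper? (ends G) φ))
P-as-sum G q = trans (length-filter (weakProper? (H G)) (allColourings _ q))
  (∑C-cong _ q (λ φ → ind-⇔ (weakProper? (H G) φ) (proper? (ends G) φ)
    (λ wp f → two-colours⇒non-mono _ _ _ (wp f))
    (λ pr f → non-mono⇒two-colours _ _ _ (pr f))))
  where
  length-filter : {A : Set} {B : A → Set} (d : ∀ x → Dec (B x)) (xs : List A) →
                  length (filter d xs) ≡ ∑ xs (λ x → ind (d x))
  length-filter d []       = refl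
  length-filter d (x ∷ xs) with d x
  ... | yes _ = cong suc (length-filter d xs)
  ... | no _  = length-filter d xs

proper-ext : {n m q : ℕ} (ends : Fin m → Fin n × Fin n) →
             Extensional {n + m} {q} (λ φ → ind (proper? ends φ))
proper-ext {n} {m} ends {φ} {ψ} φ≗ψ = noMono-cong _ _ (λ f →
  cong₂ _,_ (φ≗ψ _) (cong₂ _,_ (φ≗ψ _) (φ≗ψ (n ↑ʳ f))))

Agree : {n m : ℕ} (ends : Fin m → Fin n × Fin n) (x y : Fin n) (q : ℕ) → ℕ
Agree {n} {m} ends x y q =
  ∑C (n + m) q (λ ψ → ind (ψ (x ↑ˡ m) ≟ ψ (y ↑ˡ m)) * ind (proper? ends ψ))

agree-self : {n m : ℕ} (ends : Fin m → Fin n × Fin n) (x : Fin n) (q : ℕ) →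
             Agree ends x x q ≡ P (H (mkMG n m ends)) q
agree-self {n} {m} ends x q = trans
  (∑C-cong (n + m) q (λ ψ → trans (cong (_* ind (proper? ends ψ)) (ind-yes (ψ (x ↑ˡ m) ≟ ψ (x ↑ˡ m)) refl))
                                   (+-identityʳ _)))
  (sym (P-as-sum (mkMG n m ends) q))

-- The vertices of H_G for G with n vertices and suc m edges, relabelled so that
-- the hyperedge vertex w_e comes first and the others keep their order;
-- the remaining n + m vertices are those of H_{G-e}.
module EdgeToFront (n m : ℕ) (e : Fin (suc m)) where

  toFront : Fin (n + suc m) → Fin (suc (n + m))
  toFront j with splitAt n j
  ... | inj₁ x = suc (x ↑ˡ m)
  ... | inj₂ f with e ≟ f
  ...   | yes _   = zero
  ...   | no e≢f  = suc (n ↑ʳ punchOut e≢f)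

  fromFront : Fin (suc (n + m)) → Fin (n + suc m)
  fromFront zero = n ↑ʳ e
  fromFront (suc j) with splitAt n j
  ... | inj₁ x = x ↑ˡ suc m
  ... | inj₂ f = n ↑ʳ punchIn e f

  toFront-vertex : ∀ x → toFront (x ↑ˡ suc m) ≡ suc (x ↑ˡ m)
  toFront-vertex x rewrite splitAt-↑ˡ n x (suc m) = refl

  toFront-e : toFront (n ↑ʳ e) ≡ zero
  toFront-e rewrite splitAt-↑ʳ n (suc m) e with e ≟ e
  ... | yes _  = refl
  ... | no e≢e = contradiction refl e≢e

  toFront-edge : ∀ f → toFront (n ↑ʳ punchIn e f) ≡ suc (n ↑ʳ f)
  toFront-edge f rewrite splitAt-↑ʳ n (suc m) (punchIn e f) with e ≟ punchIn e f
  ... | yes e≡ = contradiction (sym e≡) (punchInᵢ≢i e f)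
  ... | no e≢  = cong (λ g → suc (n ↑ʳ g)) (trans (punchOut-cong e refl) (punchOut-punchIn e))

  from-to : ∀ j → fromFront (toFront j) ≡ j
  from-to j with splitAt n j in eq
  ... | inj₁ x rewrite splitAt-↑ˡ n x m = splitAt⁻¹-↑ˡ eq
  ... | inj₂ f with e ≟ f
  ...   | yes refl = splitAt⁻¹-↑ʳ eq
  ...   | no e≢f rewrite splitAt-↑ʳ n m (punchOut e≢f) =
    trans (cong (n ↑ʳ_) (punchIn-punchOut e≢f)) (splitAt⁻¹-↑ʳ eq)

  to-from : ∀ j → toFront (fromFront j) ≡ j
  to-from zero = toFront-e
  to-from (suc j) with splitAt n j in eq
  ... | inj₁ x = trans (toFront-vertex x) (cong suc (splitAt⁻¹-↑ˡ eq))
  ... | inj₂ f = trans (toFront-edge f) (cong suc (splitAt⁻¹-↑ʳ eq))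

  -- Colour the rest like ψ and w_e with c: edge e sees (ψ u, ψ v, c), the other
  -- edges see exactly what they see in H_{G-e} under ψ.
  isolate-edge : (q : ℕ) (ends : Fin (suc m) → Fin n × Fin n) {u v : Fin n} → ends e ≡ (u , v) →
    P (H (mkMG n (suc m) ends)) q ≡
    ∑ (allFin' q) (λ c → ∑C (n + m) q (λ ψ →
      ind (¬? (monochromatic? (ψ (u ↑ˡ m) , ψ (v ↑ˡ m) , c))) * ind (proper? (ends ∘ punchIn e) ψ)))
  isolate-edge q ends {u} {v} eq =
    trans (P-as-sum (mkMG n (suc m) ends) q)
    (trans (∑C-peel (n + suc m) (n + m) q toFront fromFront from-to to-from _ (proper-ext ends))
           (∑-cong (allFin' q) (λ c → ∑C-cong (n + m) q (λ ψ →
              trans (noMono-punchIn (edgeColours ends (consC c ψ ∘ toFront)) e)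
                    (cong₂ _*_ (cong (ind ∘ ¬? ∘ monochromatic?) (edge-e c ψ))
                               (noMono-cong _ _ (other-edges c ψ)))))))
    where
    vertex : ∀ c ψ x → consC c ψ (toFront (x ↑ˡ suc m)) ≡ ψ (x ↑ˡ m)
    vertex c ψ x = cong (consC c ψ) (toFront-vertex x)
    edge-e : ∀ c (ψ : Colouring (n + m) q) →
             edgeColours ends (consC c ψ ∘ toFront) e ≡ (ψ (u ↑ˡ m) , ψ (v ↑ˡ m) , c)
    edge-e c ψ = cong₂ _,_ (trans (vertex c ψ _) (cong (λ uv → ψ (proj₁ uv ↑ˡ m)) eq))
                  (cong₂ _,_ (trans (vertex c ψ _) (cong (λ uv → ψ (proj₂ uv ↑ˡ m)) eq))
                             (cong (consC c ψ) toFront-e))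
    other-edges : ∀ c ψ f → edgeColours ends (consC c ψ ∘ toFront) (punchIn e f)
                            ≡ edgeColours (ends ∘ punchIn e) ψ f
    other-edges c ψ f = cong₂ _,_ (vertex c ψ _)
                          (cong₂ _,_ (vertex c ψ _) (cong (consC c ψ) (toFront-edge f)))

  -- Deletion identity: P(H_G) + Agree_{G-e}(u,v) = q · P(H_{G-e}) for an edge e = uv,
  -- since for each colouring of H_{G-e} there are q - [ψ u ≡ ψ v] admissible colours of w_e.
  deletion-identity : (q : ℕ) (ends : Fin (suc m) → Fin n × Fin n) {u v : Fin n} → ends e ≡ (u , v) →
    P (H (mkMG n (suc m) ends)) q + Agree (ends ∘ punchIn e) u v q
      ≡ q * P (H (mkMG n m (ends ∘ punchIn e))) q
  deletion-identity q ends {u} {v} eq = begin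
      P (H (mkMG n (suc m) ends)) q + Agree ends' u v q
    ≡⟨ cong (_+ Agree ends' u v q) (isolate-edge q ends eq) ⟩
      ∑ (allFin' q) (λ c → ∑C (n + m) q (λ ψ → nonMono ψ c * W ψ)) + Agree ends' u v q
    ≡⟨ cong (_+ Agree ends' u v q) (∑-swap (allFin' q) (allColourings (n + m) q) _) ⟩
      ∑C (n + m) q (λ ψ → ∑ (allFin' q) (λ c → nonMono ψ c * W ψ)) + Agree ends' u v q
    ≡⟨ sym (∑-+ (allColourings (n + m) q) _ _) ⟩
      ∑C (n + m) q (λ ψ → ∑ (allFin' q) (λ c → nonMono ψ c * W ψ) + agree ψ * W ψ)
    ≡⟨ ∑C-cong (n + m) q admissible-colours ⟩
      ∑C (n + m) q (λ ψ → q * W ψ)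
    ≡⟨ ∑-*ˡ q (allColourings (n + m) q) W ⟩
      q * ∑C (n + m) q W
    ≡⟨ cong (q *_) (sym (P-as-sum (mkMG n m ends') q)) ⟩
      q * P (H (mkMG n m ends')) q ∎
    where
    open ≡-Reasoning
    ends' = ends ∘ punchIn e
    W : Colouring (n + m) q → ℕ
    W ψ = ind (proper? ends' ψ)
    agree : Colouring (n + m) q → ℕ
    agree ψ = ind (ψ (u ↑ˡ m) ≟ ψ (v ↑ˡ m))
    nonMono : Colouring (n + m) q → Fin q → ℕ
    nonMono ψ c = ind (¬? (monochromatic? (ψ (u ↑ˡ m) , ψ (v ↑ˡ m) , c)))
    admissible-colours : ∀ ψ → ∑ (allFin' q) (λ c → nonMono ψ c * W ψ) + agree ψ * W ψ ≡ q * W ψ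
    admissible-colours ψ = begin
        ∑ (allFin' q) (λ c → nonMono ψ c * W ψ) + agree ψ * W ψ
      ≡⟨ cong (_+ agree ψ * W ψ) (∑-*ʳ (W ψ) (allFin' q) (nonMono ψ)) ⟩
        ∑ (allFin' q) (nonMono ψ) * W ψ + agree ψ * W ψ
      ≡⟨ sym (*-distribʳ-+ (W ψ) (∑ (allFin' q) (nonMono ψ)) (agree ψ)) ⟩
        (∑ (allFin' q) (nonMono ψ) + agree ψ) * W ψ
      ≡⟨ cong (_* W ψ) (non-mono-count q (ψ (u ↑ˡ m)) (ψ (v ↑ˡ m))) ⟩
        q * W ψ ∎

transpose-back : {q : ℕ} (a b : Fin q) → transpose a b ⟨$⟩ˡ b ≡ a
transpose-back a b rewrite dec-true (b ≟ b) refl = refl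

-- Suppose the vertices of G are split into two sides by s : Fin n → Bool with no
-- edge between the sides.  Then permuting the colours on one side preserves weak
-- properness of H_G, so the colours of a vertex u on side false and a vertex v on
-- side true are independent: P(H_G) = q · Agree_G(u, v).
module SeparatedSides {n m : ℕ} (q : ℕ) (ends : Fin m → Fin n × Fin n) (s : Fin n → Bool)
                      (s-edge : ∀ f → s (proj₁ (ends f)) ≡ s (proj₂ (ends f))) where

  -- The side of a vertex of H_G: w_f lies on the side of the ends of f.
  side : Fin (n + m) → Bool
  side j with splitAt n j
  ... | inj₁ x = s x
  ... | inj₂ f = s (proj₁ (ends f))

  side-vertex : ∀ x → side (x ↑ˡ m) ≡ s x
  side-vertex x rewrite splitAt-↑ˡ n x m = refl

  side-edge : ∀ f → side (n ↑ʳ f) ≡ s (proj₁ (ends f))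
  side-edge f rewrite splitAt-↑ʳ n m f = refl

  act : Permutation q q → Bool → Fin q → Fin q
  act π true  = π ⟨$⟩ʳ_
  act π false = id

  act-inverse : ∀ π t c → act (flip π) t (act π t c) ≡ c
  act-inverse π true  c = inverseˡ π
  act-inverse π false c = refl

  act-injective : ∀ π t {c d} → act π t c ≡ act π t d → c ≡ d
  act-injective π t {c} {d} eq =
    trans (sym (act-inverse π t c)) (trans (cong (act (flip π) t) eq) (act-inverse π t d))

  permuteSide : Permutation q q → Colouring (n + m) q → Colouring (n + m) q
  permuteSide π ψ j = act π (side j) (ψ j)

  edge-one-side : ∀ π ψ f → edgeColours ends (permuteSide π ψ) f ≡
    (let g = act π (s (proj₁ (ends f))) ; (a , b , c) = edgeColours ends ψ f in (g a , g b , g c))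
  edge-one-side π ψ f = cong₂ _,_ (cong (λ t → act π t _) (side-vertex _))
    (cong₂ _,_ (cong (λ t → act π t _) (trans (side-vertex _) (sym (s-edge f))))
               (cong (λ t → act π t _) (side-edge f)))

  proper-permuteSide : ∀ π ψ → ind (proper? ends (permuteSide π ψ)) ≡ ind (proper? ends ψ)
  proper-permuteSide π ψ = ind-⇔ (proper? ends (permuteSide π ψ)) (proper? ends ψ)
    (λ pr f mono → pr f (subst Monochromatic (sym (edge-one-side π ψ f)) (mono-map f mono)))
    (λ pr f mono → pr f (mono-unmap f (subst Monochromatic (edge-one-side π ψ f) mono)))
    where
    mono-map : ∀ f {a b c} → Monochromatic (a , b , c) →
               let g = act π (s (proj₁ (ends f))) in Monochromatic (g a , g b , g c)
    mono-map f (refl , refl) = refl , refl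
    mono-unmap : ∀ f {a b c} → let g = act π (s (proj₁ (ends f))) in
                 Monochromatic (g a , g b , g c) → Monochromatic (a , b , c)
    mono-unmap f (ab , bc) = act-injective π (s (proj₁ (ends f))) ab , act-injective π (s (proj₁ (ends f))) bc

  module _ (u v : Fin n) (u-side : s u ≡ false) (v-side : s v ≡ true) where

    W : Colouring (n + m) q → ℕ
    W ψ = ind (proper? ends ψ)

    pinned : Fin q → Fin q → Colouring (n + m) q → ℕ
    pinned a b ψ = W ψ * (ind (ψ (u ↑ˡ m) ≟ a) * ind (ψ (v ↑ˡ m) ≟ b))

    pinned-ext : ∀ a b → Extensional (pinned a b)
    pinned-ext a b ψ≗ψ' = cong₂ _*_ (proper-ext ends ψ≗ψ')
      (cong₂ _*_ (cong (λ c → ind (c ≟ a)) (ψ≗ψ' _)) (cong (λ c → ind (c ≟ b)) (ψ≗ψ' _)))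

    pinned-permute : ∀ π a b → ∑C (n + m) q (pinned a b) ≡ ∑C (n + m) q (pinned a (π ⟨$⟩ˡ b))
    pinned-permute π a b =
      trans (∑C-reindex (n + m) (n + m) q (permuteSide π) (permuteSide (flip π))
               (λ ψ≗ j → cong (act π (side j)) (ψ≗ j)) (λ ψ≗ j → cong (act (flip π) (side j)) (ψ≗ j))
               (λ ψ j → act-inverse π (side j) (ψ j)) (λ ψ j → act-inverse (flip π) (side j) (ψ j))
               (pinned a b) (pinned-ext a b))
            (∑C-cong (n + m) q (λ ψ → cong₂ _*_ (proper-permuteSide π ψ)
               (cong₂ _*_ (cong (λ c → ind (c ≟ a)) (fix-u ψ)) (move-v ψ))))
      where
      fix-u : ∀ ψ → permuteSide π ψ (u ↑ˡ m) ≡ ψ (u ↑ˡ m)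
      fix-u ψ = cong (λ t → act π t (ψ (u ↑ˡ m))) (trans (side-vertex u) u-side)
      move-v : ∀ ψ → ind (permuteSide π ψ (v ↑ˡ m) ≟ b) ≡ ind (ψ (v ↑ˡ m) ≟ π ⟨$⟩ˡ b)
      move-v ψ rewrite side-vertex v | v-side = ind-⇔ (π ⟨$⟩ʳ ψ (v ↑ˡ m) ≟ b) (ψ (v ↑ˡ m) ≟ π ⟨$⟩ˡ b)
        (λ eq → trans (sym (inverseˡ π)) (cong (π ⟨$⟩ˡ_) eq))
        (λ eq → trans (cong (π ⟨$⟩ʳ_) eq) (inverseʳ π))

    pinned-diagonal : ∀ a b → ∑C (n + m) q (pinned a b) ≡ ∑C (n + m) q (pinned a a)
    pinned-diagonal a b = trans (pinned-permute (transpose a b) a b)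
                                (cong (λ c → ∑C (n + m) q (pinned a c)) (transpose-back a b))

    separated-count : P (H (mkMG n m ends)) q ≡ q * Agree ends u v q
    separated-count = begin
        P (H (mkMG n m ends)) q
      ≡⟨ P-as-sum (mkMG n m ends) q ⟩
        ∑C (n + m) q W
      ≡⟨ ∑C-cong (n + m) q (λ ψ → sym (pin-both ψ)) ⟩
        ∑C (n + m) q (λ ψ → ∑ (allFin' q) (λ a → ∑ (allFin' q) (λ b → pinned a b ψ)))
      ≡⟨ sym (∑-swap (allFin' q) (allColourings (n + m) q) _) ⟩
        ∑ (allFin' q) (λ a → ∑C (n + m) q (λ ψ → ∑ (allFin' q) (λ b → pinned a b ψ)))
      ≡⟨ ∑-cong (allFin' q) (λ a → sym (∑-swap (allFin' q) (allColourings (n + m) q) _)) ⟩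
        ∑ (allFin' q) (λ a → ∑ (allFin' q) (λ b → ∑C (n + m) q (pinned a b)))
      ≡⟨ ∑-cong (allFin' q) (λ a → trans (∑-cong (allFin' q) (pinned-diagonal a))
                                         (∑-colours-const q _)) ⟩
        ∑ (allFin' q) (λ a → q * ∑C (n + m) q (pinned a a))
      ≡⟨ ∑-*ˡ q (allFin' q) _ ⟩
        q * ∑ (allFin' q) (λ a → ∑C (n + m) q (pinned a a))
      ≡⟨ cong (q *_) (∑-swap (allFin' q) (allColourings (n + m) q) _) ⟩
        q * ∑C (n + m) q (λ ψ → ∑ (allFin' q) (λ a → pinned a a ψ))
      ≡⟨ cong (q *_) (∑C-cong (n + m) q pin-equal) ⟩
        q * Agree ends u v q ∎
      where
      open ≡-Reasoning
      regroup : ∀ x y z → x * (y * z) ≡ x * y * z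
      regroup x y z = sym (*-assoc x y z)
      pin-both : ∀ ψ → ∑ (allFin' q) (λ a → ∑ (allFin' q) (λ b → pinned a b ψ)) ≡ W ψ
      pin-both ψ = trans
        (∑-cong (allFin' q) (λ a → trans (∑-cong (allFin' q) (λ b → regroup (W ψ) _ _))
                                         (∑-colours-δ q (λ _ → W ψ * ind (ψ (u ↑ˡ m) ≟ a)) (ψ (v ↑ˡ m)))))
        (∑-colours-δ q (λ _ → W ψ) (ψ (u ↑ˡ m)))
      pin-equal : ∀ ψ → ∑ (allFin' q) (λ a → pinned a a ψ) ≡ ind (ψ (u ↑ˡ m) ≟ ψ (v ↑ˡ m)) * W ψ
      pin-equal ψ = trans (∑-cong (allFin' q) (λ a → regroup (W ψ) _ _))
        (trans (∑-colours-δ q (λ a → W ψ * ind (ψ (u ↑ˡ m) ≟ a)) (ψ (v ↑ˡ m))) (*-comm (W ψ) _))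

-- The vertices of H_G are relabelled so that v comes first and the
-- remaining k + m vertices are those of H_{G/uv}.
module IdentifyEnds {k m : ℕ} (q : ℕ) (ends : Fin m → Fin (suc k) × Fin (suc k))
                    (u v : Fin (suc k)) (v≢u : v ≢ u) where

  mergedEnds : Fin m → Fin k × Fin k
  mergedEnds f = merge u v v≢u (proj₁ (ends f)) , merge u v v≢u (proj₂ (ends f))

  toFront : Fin (suc k + m) → Fin (suc (k + m))
  toFront j with splitAt (suc k) j
  ... | inj₂ f = suc (k ↑ʳ f)
  ... | inj₁ x with v ≟ x
  ...   | yes _  = zero
  ...   | no v≢x = suc (punchOut v≢x ↑ˡ m)

  fromFront : Fin (suc (k + m)) → Fin (suc k + m)
  fromFront zero = v ↑ˡ m
  fromFront (suc j) with splitAt k j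
  ... | inj₁ x = punchIn v x ↑ˡ m
  ... | inj₂ f = suc k ↑ʳ f

  from-to : ∀ j → fromFront (toFront j) ≡ j
  from-to j with splitAt (suc k) j in eq
  ... | inj₂ f rewrite splitAt-↑ʳ k m f = splitAt⁻¹-↑ʳ eq
  ... | inj₁ x with v ≟ x
  ...   | yes refl = splitAt⁻¹-↑ˡ eq
  ...   | no v≢x rewrite splitAt-↑ˡ k (punchOut v≢x) m =
    trans (cong (_↑ˡ m) (punchIn-punchOut v≢x)) (splitAt⁻¹-↑ˡ eq)

  to-from : ∀ j → toFront (fromFront j) ≡ j
  to-from zero rewrite splitAt-↑ˡ (suc k) v m with v ≟ v
  ... | yes _  = refl
  ... | no v≢v = contradiction refl v≢v
  to-from (suc j) with splitAt k j in eq
  ... | inj₂ f rewrite splitAt-↑ʳ (suc k) m f = cong suc (splitAt⁻¹-↑ʳ eq)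
  ... | inj₁ x rewrite splitAt-↑ˡ (suc k) (punchIn v x) m with v ≟ punchIn v x
  ...   | yes v≡ = contradiction (sym v≡) (punchInᵢ≢i v x)
  ...   | no v≢  = cong suc (trans (cong (_↑ˡ m) (trans (punchOut-cong v refl) (punchOut-punchIn v)))
                                   (splitAt⁻¹-↑ˡ eq))

  ū : Fin k
  ū = punchOut v≢u

  lift : Fin q → Colouring (k + m) q → Colouring (suc k + m) q
  lift c ψ = consC c ψ ∘ toFront

  lift-u : ∀ c ψ → lift c ψ (u ↑ˡ m) ≡ ψ (ū ↑ˡ m)
  lift-u c ψ rewrite splitAt-↑ˡ (suc k) u m with v ≟ u
  ... | yes v≡u = contradiction v≡u v≢u
  ... | no _    = cong (λ x → ψ (x ↑ˡ m)) (punchOut-cong v refl)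

  lift-v : ∀ c ψ → lift c ψ (v ↑ˡ m) ≡ c
  lift-v c ψ = cong (consC c ψ) (to-from zero)

  lift-agreeing : ∀ ψ f → edgeColours ends (lift (ψ (ū ↑ˡ m)) ψ) f ≡ edgeColours mergedEnds ψ f
  lift-agreeing ψ f = cong₂ _,_ (vertex (proj₁ (ends f))) (cong₂ _,_ (vertex (proj₂ (ends f))) hyperedge-vertex)
    where
    vertex : ∀ x → lift (ψ (ū ↑ˡ m)) ψ (x ↑ˡ m) ≡ ψ (merge u v v≢u x ↑ˡ m)
    vertex x rewrite splitAt-↑ˡ (suc k) x m with v ≟ x
    ... | yes _ = refl
    ... | no _  = refl
    hyperedge-vertex : lift (ψ (ū ↑ˡ m)) ψ (suc k ↑ʳ f) ≡ ψ (k ↑ʳ f)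
    hyperedge-vertex rewrite splitAt-↑ʳ (suc k) m f = refl

  identify-count : Agree ends u v q ≡ P (H (mkMG k m mergedEnds)) q
  identify-count = begin
      Agree ends u v q
    ≡⟨ ∑C-peel (suc k + m) (k + m) q toFront fromFront from-to to-from _ agree-ext ⟩
      ∑ (allFin' q) (λ c → ∑C (k + m) q (λ ψ →
        ind (lift c ψ (u ↑ˡ m) ≟ lift c ψ (v ↑ˡ m)) * W (lift c ψ)))
    ≡⟨ ∑-cong (allFin' q) (λ c → ∑C-cong (k + m) q (λ ψ →
         trans (cong₂ (λ a b → ind (a ≟ b) * W (lift c ψ)) (lift-u c ψ) (lift-v c ψ))
               (*-comm (ind (ψ (ū ↑ˡ m) ≟ c)) (W (lift c ψ))))) ⟩
      ∑ (allFin' q) (λ c → ∑C (k + m) q (λ ψ → W (lift c ψ) * ind (ψ (ū ↑ˡ m) ≟ c)))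
    ≡⟨ ∑-swap (allFin' q) (allColourings (k + m) q) _ ⟩
      ∑C (k + m) q (λ ψ → ∑ (allFin' q) (λ c → W (lift c ψ) * ind (ψ (ū ↑ˡ m) ≟ c)))
    ≡⟨ ∑C-cong (k + m) q (λ ψ → ∑-colours-δ q (λ c → W (lift c ψ)) (ψ (ū ↑ˡ m))) ⟩
      ∑C (k + m) q (λ ψ → W (lift (ψ (ū ↑ˡ m)) ψ))
    ≡⟨ ∑C-cong (k + m) q (λ ψ → noMono-cong _ _ (lift-agreeing ψ)) ⟩
      ∑C (k + m) q (λ ψ → ind (proper? mergedEnds ψ))
    ≡⟨ sym (P-as-sum (mkMG k m mergedEnds) q) ⟩
      P (H (mkMG k m mergedEnds)) q ∎
    where
    open ≡-Reasoning
    W : Colouring (suc k + m) q → ℕ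
    W χ = ind (proper? ends χ)
    agree-ext : Extensional (λ χ → ind (χ (u ↑ˡ m) ≟ χ (v ↑ˡ m)) * W χ)
    agree-ext χ≗χ' = cong₂ _*_ (cong₂ (λ a b → ind (a ≟ b)) (χ≗χ' _) (χ≗χ' _)) (proper-ext ends χ≗χ')

Adj-sym : (G : Multigraph) {x y : Fin (order G)} → Adj G x y → Adj G y x
Adj-sym G (f , inj₁ p) = f , inj₂ p
Adj-sym G (f , inj₂ p) = f , inj₁ p

connected-transfer : {n m m' : ℕ} {ends : Fin m → Fin n × Fin n} {ends' : Fin m' → Fin n × Fin n} →
  (∀ {x y} → Adj (mkMG n m ends) x y → Connected (mkMG n m' ends') x y) →
  ∀ {x y} → Connected (mkMG n m ends) x y → Connected (mkMG n m' ends') x y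
connected-transfer edge-path = Star.concat ∘ Star.map edge-path

-- If connectivity in G implies connectivity in G', then G' has at most as many components:
-- choosing a vertex in each component of G' and taking its G-component is injective.
components-antitone : {n m m' c c' : ℕ} {ends : Fin m → Fin n × Fin n} {ends' : Fin m' → Fin n × Fin n} →
  (∀ {x y} → Connected (mkMG n m ends) x y → Connected (mkMG n m' ends') x y) →
  HasComponents (mkMG n m ends) c → HasComponents (mkMG n m' ends') c' → c' ≤ c
components-antitone {n} {c' = c'} finer (label , _ , label-conn) (label' , label'-onto , label'-conn) =
  injective⇒≤ {f = label ∘ representative} representative-injective
  where
  representative : Fin c' → Fin n
  representative k = proj₁ (label'-onto k)
  represents : ∀ k → label' (representative k) ≡ k
  represents k = proj₂ (label'-onto k) refl
  representative-injective : ∀ {k l} → label (representative k) ≡ label (representative l) → k ≡ l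
  representative-injective {k} {l} same = trans (sym (represents k))
    (trans (Equivalence.from (label'-conn _ _) (finer (Equivalence.to (label-conn _ _) same)))
           (represents l))

deletion-keeps-connectivity : (n m : ℕ) (ends : Fin (suc m) → Fin n × Fin n) (e : Fin (suc m)) →
  Connected (mkMG n m (ends ∘ punchIn e)) (proj₁ (ends e)) (proj₂ (ends e)) →
  ∀ {x y} → Connected (mkMG n (suc m) ends) x y → Connected (mkMG n m (ends ∘ punchIn e)) x y
deletion-keeps-connectivity n m ends e ends-connected = connected-transfer edge-path
  where
  G-e = mkMG n m (ends ∘ punchIn e)
  edge-path : ∀ {x y} → Adj (mkMG n (suc m) ends) x y → Connected G-e x y
  edge-path {x} {y} (f , p) with e ≟ f
  edge-path (f , inj₁ refl) | yes refl = ends-connected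
  edge-path (f , inj₂ refl) | yes refl = reverse (Adj-sym G-e) ends-connected
  ... | no e≢f = (punchOut e≢f , subst (λ g → ends g ≡ (x , y) ⊎ ends g ≡ (y , x))
                                       (sym (punchIn-punchOut e≢f)) p) ◅ ε

bridge-ends-disconnected : (n m : ℕ) (ends : Fin (suc m) → Fin n × Fin n) (e : Fin (suc m)) →
  IsBridge (mkMG n (suc m) ends) e → {u v : Fin n} → ends e ≡ (u , v) →
  ¬ Connected (mkMG n m (ends ∘ punchIn e)) u v
bridge-ends-disconnected n m ends e (c , c' , comps , comps' , c<c') refl ends-connected =
  <⇒≱ c<c' (components-antitone (deletion-keeps-connectivity n m ends e ends-connected) comps comps')

module ComponentOf (G : Multigraph) {c : ℕ} (comps : HasComponents G c) (v : Fin (order G)) where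

  label : Fin (order G) → Fin c
  label = proj₁ comps

  inComponent : Fin (order G) → Bool
  inComponent x = does (label x ≟ label v)

  inComponent-edge : ∀ f → inComponent (proj₁ (ends G f)) ≡ inComponent (proj₂ (ends G f))
  inComponent-edge f = cong (λ l → does (l ≟ label v))
    (Equivalence.from (proj₂ (proj₂ comps) _ _) ((f , inj₁ refl) ◅ ε))

  inComponent-self : inComponent v ≡ true
  inComponent-self = dec-true (label v ≟ label v) refl

  inComponent-other : {u : Fin (order G)} → ¬ Connected G u v → inComponent u ≡ false
  inComponent-other u≁v = dec-false (label _ ≟ label v) (u≁v ∘ Equivalence.to (proj₂ (proj₂ comps) _ _))

cancel-summand : (a b k : ℕ) → a + b ≡ k * b → a ≡ (k ∸ 1) * b
cancel-summand a b k a+b≡kb = begin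
    a              ≡⟨ sym (m+n∸n≡m a b) ⟩
    a + b ∸ b      ≡⟨ cong₂ _∸_ a+b≡kb (sym (*-identityˡ b)) ⟩
    k * b ∸ 1 * b  ≡⟨ sym (*-distribʳ-∸ b k 1) ⟩
    (k ∸ 1) * b    ∎
  where open ≡-Reasoning

edgeless : (G : Multigraph) → size G ≡ 0 → (q : ℕ) → P (H G) q ≡ q ^ order G
edgeless (mkMG n zero ends) refl q = begin
    P (H (mkMG n 0 ends)) q
  ≡⟨ P-as-sum (mkMG n 0 ends) q ⟩
    ∑C (n + 0) q (λ φ → ind (proper? ends φ))
  ≡⟨ ∑C-cong (n + 0) q (λ φ → ind-yes (proper? ends φ) (λ ())) ⟩
    ∑C (n + 0) q (λ _ → 1)
  ≡⟨ ∑C-one (n + 0) q ⟩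
    q ^ (n + 0)
  ≡⟨ cong (q ^_) (+-identityʳ n) ⟩
    q ^ n ∎
  where open ≡-Reasoning

-- (b) For a loop e = uu the agreement count of G - e is all of P(H_{G-e}).
loop-deletion : (G : Multigraph) (e : Fin (size G)) → proj₁ (ends G e) ≡ proj₂ (ends G e) →
                (q : ℕ) → P (H G) q ≡ (q ∸ 1) * P (H (delete G e)) q
loop-deletion (mkMG n zero ends) () loop q
loop-deletion (mkMG n (suc m) ends) e loop q = cancel-summand _ _ q (begin
    P (H (mkMG n (suc m) ends)) q + P (H (mkMG n m ends')) q
  ≡⟨ cong (P (H (mkMG n (suc m) ends)) q +_) (sym (agree-self ends' u q)) ⟩
    P (H (mkMG n (suc m) ends)) q + Agree ends' u u q
  ≡⟨ EdgeToFront.deletion-identity n m e q ends (cong (u ,_) (sym loop)) ⟩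
    q * P (H (mkMG n m ends')) q ∎)
  where
  open ≡-Reasoning
  ends' = ends ∘ punchIn e
  u = proj₁ (ends e)

-- (c) For a bridge e = uv (u ≢ v) with B = Agree_{G-e}(u, v):
-- P(H_G) + B = q · P(H_{G-e}) = q · (q · B), and B = P(H_{G/e}).
bridge-contraction : (G : Multigraph) (e : Fin (size G)) → IsBridge G e →
                     (q : ℕ) → P (H G) q ≡ (q ^ 2 ∸ 1) * P (H (contract G e)) q
bridge-contraction (mkMG n zero ends) () bridge q
bridge-contraction (mkMG n (suc m) ends) e bridge q with ends e in ends-e
... | u , v with v ≟ u
...   | yes refl = ⊥-elim (bridge-ends-disconnected n m ends e bridge ends-e ε)
bridge-contraction (mkMG zero (suc m) ends) e bridge q | () , v | no _
bridge-contraction (mkMG (suc k) (suc m) ends) e bridge@(_ , _ , _ , comps' , _) q | u , v | no v≢u =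
  trans (cancel-summand _ _ (q ^ 2) (begin
      P (H (mkMG (suc k) (suc m) ends)) q + B
    ≡⟨ EdgeToFront.deletion-identity (suc k) m e q ends ends-e ⟩
      q * P (H (mkMG (suc k) m ends')) q
    ≡⟨ cong (q *_) (SeparatedSides.separated-count q ends' inComponent inComponent-edge u v
                      (inComponent-other (bridge-ends-disconnected (suc k) m ends e bridge ends-e))
                      inComponent-self) ⟩
      q * (q * B)
    ≡⟨ trans (sym (*-assoc q q B)) (cong (λ r → q * r * B) (sym (*-identityʳ q))) ⟩
      q ^ 2 * B ∎))
    (cong ((q ^ 2 ∸ 1) *_) (IdentifyEnds.identify-count q ends' u v v≢u))
  where
  open ≡-Reasoning
  ends' = ends ∘ punchIn e
  B = Agree ends' u v q
  open ComponentOf (mkMG (suc k) m ends') comps' v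

proposition6 :
    ((G : Multigraph) → size G ≡ 0 → (q : ℕ) → 1 ≤ q →
      P (H G) q ≡ q ^ order G)
    ×
    ((G : Multigraph) (e : Fin (size G)) → proj₁ (ends G e) ≡ proj₂ (ends G e) →
      (q : ℕ) → 1 ≤ q → P (H G) q ≡ (q ∸ 1) * P (H (delete G e)) q)
    ×
    ((G : Multigraph) (e : Fin (size G)) → IsBridge G e →
      (q : ℕ) → 1 ≤ q → P (H G) q ≡ (q ^ 2 ∸ 1) * P (H (contract G e)) q)
proposition6 =
  (λ G no-edges q _ → edgeless G no-edges q) ,
  (λ G e loop q _ → loop-deletion G e loop q) ,
  (λ G e bridge q _ → bridge-contraction G e bridge q)
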